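{- For every integer $\ell \geq 3$ there is a constant $c(\ell)$ depending only on $\ell$ such that for all $n$, \[ \mathrm{ex}^*(n, C_\ell, P_\ell) \leq (2\ell-3)^{\ell-2}\cdot \mathrm{ex}^*(n, P_\ell) \leq c(\ell)\, n. \]
   Context: An edge-coloring is proper if any two edges sharing a vertex receive different colors. An edge-colored subgraph is rainbow if no two of its edges have the same color. $P_\ell$ denotes the path with $\ell$ edges and $C_\ell$ the cycle of length $\ell$. $\mathrm{ex}^*(n,F)$ is the maximum number of edges in an $n$-vertex simple graph with a proper edge-coloring containing no rainbow copy of $F$. $\mathrm{ex}^*(n,H,F)$ is the maximum number of rainbow copies of $H$ (as subgraphs) in an $n$-vertex simple graph with a proper edge-coloring containing no rainbow copy of $F$. -}

module Defs where

open import Data.Nat using (ℕ; zero; suc; _+_; _*_; _≤_; _<?_)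
open import Data.Nat.DivMod using (_/_)
import Data.Nat.Properties as ℕP
open import Data.Fin using (Fin; toℕ)
import Data.Fin.Properties as FinP
open import Data.List using (List; []; _∷_; [_]; _++_; length; filter; map; concatMap)
open import Data.Nat.ListAction using (sum)
open import Data.List.Relation.Unary.Unique.Propositional using (Unique)
import Data.List.Relation.Unary.Unique.DecPropositional as UDec
open import Data.List.Properties using (≡-dec)
open import Data.Fin using () renaming (_≟_ to _≟F_)
open import Data.Maybe using (Maybe; just; nothing; is-just)
import Data.Maybe.Properties as MaybeP
open import Data.Bool using (Bool; true; false; T)
open import Data.Product using (Σ; ∃; ∃-syntax; _×_; _,_)
open import Data.List.Fresh using ()
open import Relation.Nullary using (Dec; yes; no; ¬_)
open import Relation.Nullary.Decidable using (_×-dec_)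
open import Relation.Binary.PropositionalEquality using (_≡_)
open import Data.Fin.Base using (Fin)
open import Data.List.Base using ()
open import Data.Fin using () renaming (zero to fz)
open import Data.List using () renaming (allFin to allFinL)
open import Data.Maybe using (_>>=_)
import Data.Maybe as Maybe

-- Edge-coloured simple graphs on vertex set Fin n.
-- col u v = just c  means {u,v} is an edge of colour c;
-- col u v = nothing means {u,v} is not an edge.
-- Colours are natural numbers (any finite graph uses finitely many).

record ColGraph (n : ℕ) : Set where
  field
    col   : Fin n → Fin n → Maybe ℕ
    sym   : ∀ u v → col u v ≡ col v u
    irrefl : ∀ v → col v v ≡ nothing
open ColGraph public

Proper : ∀ {n} → ColGraph n → Set
Proper G = ∀ u v w c → col G u v ≡ just c → col G u w ≡ just c → v ≡ w

edgeCount : ∀ {n} → ColGraph n → ℕ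
edgeCount {n} G =
  sum (map (λ u → length (filter (λ v → (toℕ u <? toℕ v) ×-dec isEdge u v) (allFinL n)))
           (allFinL n))
  where
  isEdge : (u v : Fin n) → Dec (T (is-just (col G u v)))
  isEdge u v = Data.Bool.T? (is-just (col G u v))
    where import Data.Bool

walkColours : ∀ {n} → ColGraph n → List (Fin n) → Maybe (List ℕ)
walkColours G (u ∷ v ∷ rest) =
  col G u v >>= λ c → Maybe.map (c ∷_) (walkColours G (v ∷ rest))
walkColours G _ = just []

-- vs is the vertex sequence of a rainbow path P_ℓ (ℓ edges, ℓ+1 distinct vertices)
RainbowPathSeq : ∀ {n} → ColGraph n → ℕ → List (Fin n) → Set
RainbowPathSeq G ℓ vs =
  length vs ≡ suc ℓ × Unique vs ×
  (∃[ cs ] (walkColours G vs ≡ just cs × Unique cs))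

HasRainbowPath : ∀ {n} → ColGraph n → ℕ → Set
HasRainbowPath G ℓ = ∃[ vs ] RainbowPathSeq G ℓ vs

RainbowCycleSeq : ∀ {n} → ColGraph n → ℕ → List (Fin n) → Set
RainbowCycleSeq G ℓ [] = length {A = ℕ} [] ≡ suc ℓ   -- impossible, empty sequence
RainbowCycleSeq G ℓ (v ∷ vs) =
  length (v ∷ vs) ≡ ℓ × Unique (v ∷ vs) ×
  (∃[ cs ] (walkColours G ((v ∷ vs) ++ [ v ]) ≡ just cs × Unique cs))

rainbowCycleSeq? : ∀ {n} (G : ColGraph n) ℓ vs → Dec (RainbowCycleSeq G ℓ vs)
rainbowCycleSeq? G ℓ [] = ℕP._≟_ 0 (suc ℓ)
rainbowCycleSeq? G ℓ (v ∷ vs) =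
  ℕP._≟_ (length (v ∷ vs)) ℓ ×-dec (UDec.unique? _≟F_ (v ∷ vs) ×-dec
    dec (walkColours G ((v ∷ vs) ++ [ v ])))
  where
  dec : (m : Maybe (List ℕ)) → Dec (∃[ cs ] (m ≡ just cs × Unique cs))
  dec nothing = no λ { (_ , () , _) }
  dec (just cs) with UDec.unique? ℕP._≟_ cs
  ... | yes u = yes (cs , _≡_.refl , u)
  ... | no ¬u = no λ { (_ , _≡_.refl , u) → ¬u u }

allLists : (n k : ℕ) → List (List (Fin n))
allLists n zero = [ [] ]
allLists n (suc k) = concatMap (λ v → map (v ∷_) (allLists n k)) (allFinL n)

-- number of rainbow copies of C_ℓ (as subgraphs) in G.
-- For ℓ ≥ 3 each copy of C_ℓ corresponds to exactly 2ℓ cyclic vertex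
-- sequences (ℓ starting points × 2 directions), so we divide by 2ℓ.
rainbowCycleCount : ∀ {n} → ColGraph n → ℕ → ℕ
rainbowCycleCount G zero = 0
rainbowCycleCount {n} G (suc k) =
  length (filter (rainbowCycleSeq? G (suc k)) (allLists n (suc k))) / (2 * suc k)

Admissible : ∀ {n} → ℕ → ColGraph n → Set
Admissible ℓ G = Proper G × ¬ HasRainbowPath G ℓ

IsMaxOver : (n ℓ : ℕ) → (ColGraph n → ℕ) → ℕ → Set
IsMaxOver n ℓ f M =
  (∃[ G ] (Admissible ℓ G × f G ≡ M)) × (∀ (G : ColGraph n) → Admissible ℓ G → f G ≤ M)

IsExStarPath : (n ℓ : ℕ) → ℕ → Set
IsExStarPath n ℓ M = IsMaxOver n ℓ edgeCount M

IsExStarCyclePath : (n ℓ : ℕ) → ℕ → Set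
IsExStarCyclePath n ℓ M = IsMaxOver n ℓ (λ G → rainbowCycleCount G ℓ) M

-- A properly coloured graph with no rainbow path with ℓ edges has at most 2ℓ·|S| edges
-- inside any vertex set S.  Otherwise deleting vertices of degree < 2ℓ one at a time leaves
-- a nonempty set of minimum degree ≥ 2ℓ, where a rainbow path grows greedily: at the head of a
-- rainbow path with j < ℓ edges only j + 1 vertices and j colours are blocked, and properness
-- makes each colour block at most one neighbour.  Hence ex*(n, P_ℓ) ≤ 2ℓn.
--
-- On a rainbow C_ℓ with vertices x v₁ … v_{ℓ-1}, every neighbour of x is some v_i or is joined to x
-- by one of the ℓ - 2 colours of the path v₁ … v_{ℓ-1}, since otherwise it extends the path
-- x v₁ … v_{ℓ-1} to a rainbow P_ℓ; so vertices on rainbow C_ℓ's have degree ≤ 2ℓ - 3.  A cyclic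
-- vertex sequence of a rainbow C_ℓ is an oriented edge v₀v₁ followed by ℓ - 2 steps out of vertices
-- of degree ≤ 2ℓ - 3, giving at most 2e(2ℓ - 3)^(ℓ-2) sequences and e(2ℓ - 3)^(ℓ-2) cycles.
--
-- Both maxima are attained because after renumbering colours there are only finitely many
-- coloured graphs on n vertices, and all quantities involved are invariant under renumbering.

module Submission where

open import Data.Bool using (Bool; true; false; _∧_; not; if_then_else_)
import Data.Bool.Properties as Boolₚ
open import Data.Empty using (⊥-elim)
open import Data.Fin using (Fin; toℕ)
import Data.Fin as Fin
import Data.Fin.Properties as Finₚ
open import Data.List using (List; []; _∷_; _++_; [_]; map; concatMap; length; filter; allFin; upTo; cartesianProduct)
open import Data.List.Extrema.Nat using (argmax; argmax-all; f[xs]≤f[argmax])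
open import Data.List.Membership.Propositional using (_∈_; _∉_; lose)
open import Data.List.Membership.Propositional.Properties
  using (∈-∃++; ∈-allFin; ∈-map⁺; ∈-concatMap⁺; ∈-cartesianProduct⁺; ∈-upTo⁺; ∈-filter⁺)
open import Data.List.Properties using (length-++; length-map; length-tabulate; ++-assoc; ++-identityʳ)
open import Data.List.Relation.Unary.All using (All; []; _∷_)
import Data.List.Relation.Unary.All as All
open import Data.List.Relation.Unary.All.Properties using (All¬⇒¬Any; ¬Any⇒All¬; ++⁻ˡ; all-filter)
open import Data.List.Relation.Unary.AllPairs using ([]; _∷_)
open import Data.List.Relation.Unary.Any using (here; there)
import Data.List.Relation.Unary.Any as Any
open import Data.List.Relation.Unary.Unique.Propositional using (Unique)
open import Data.List.Relation.Unary.Unique.Propositional.Properties using (allFin⁺; ++⁺; map⁻)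
import Data.List.Relation.Unary.Unique.DecPropositional as UniqueDec
open import Data.Maybe using (Maybe; just; nothing; is-just; fromMaybe; _>>=_)
import Data.Maybe as Maybe
import Data.Maybe.Properties as Maybeₚ
open import Data.Nat using (ℕ; zero; suc; _+_; _*_; _∸_; _^_; _≤_; _<_; z≤n; s≤s; _<?_; _≤?_; _<ᵇ_)
open import Data.Nat.DivMod using (_/_; m*n/n≡m; /-monoʳ-≤; /-monoˡ-≤)
open import Data.Nat.ListAction using (sum)
open import Data.Nat.Properties
open import Algebra.Properties.CommutativeSemigroup +-commutativeSemigroup
  using () renaming (interchange to +-interchange)
open import Data.Nat.Solver using (module +-*-Solver)
open import Data.Product using (_×_; _,_; proj₁; proj₂; ∃; ∃-syntax; ∃₂)
open import Data.Sum using (_⊎_; inj₁; inj₂)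
import Data.Vec.Functional as Vector
open import Defs renaming (sym to col-sym)
open import Relation.Binary using (DecidableEquality; tri<; tri≈; tri>)
open import Relation.Binary.PropositionalEquality hiding ([_])
open import Relation.Nullary using (Dec; yes; no; does; ¬_)
open import Relation.Nullary.Decidable using (dec-true; dec-false; map′; _×-dec_; ¬?)
open import Relation.Nullary.Reflects using (ofʸ; ofⁿ)
open import Relation.Unary using (Pred; Decidable)

-- Finite sums and counts

𝟙 : Bool → ℕ
𝟙 true  = 1
𝟙 false = 0

𝟙-∧ : ∀ b c → 𝟙 (b ∧ c) ≡ 𝟙 b * 𝟙 c
𝟙-∧ true  c = sym (+-identityʳ (𝟙 c))
𝟙-∧ false c = refl

∧≡true⁻ : ∀ a {b} → (a ∧ b) ≡ true → a ≡ true × b ≡ true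
∧≡true⁻ true b≡true = refl , b≡true

does-true⇒ : ∀ {p} {P : Set p} (P? : Dec P) → does P? ≡ true → P
does-true⇒ (yes p) _ = p

does-⇔ : ∀ {p q} {P : Set p} {Q : Set q} (P? : Dec P) (Q? : Dec Q) → (P → Q) → (Q → P) → does P? ≡ does Q?
does-⇔ (yes p) Q? P→Q _   = sym (dec-true Q? (P→Q p))
does-⇔ (no ¬p) Q? _   Q→P = sym (dec-false Q? (λ q → ¬p (Q→P q)))

module _ {a} {A : Set a} where

  ∑ : List A → (A → ℕ) → ℕ
  ∑ []       f = 0
  ∑ (x ∷ xs) f = f x + ∑ xs f

  syntax ∑ xs (λ x → e) = ∑[ x ← xs ] e

  count : (A → Bool) → List A → ℕ
  count p xs = ∑[ x ← xs ] 𝟙 (p x)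

  ∑-cong : ∀ xs {f g : A → ℕ} → (∀ x → f x ≡ g x) → ∑ xs f ≡ ∑ xs g
  ∑-cong []       f≡g = refl
  ∑-cong (x ∷ xs) f≡g = cong₂ _+_ (f≡g x) (∑-cong xs f≡g)

  ∑-mono : ∀ xs {f g : A → ℕ} → (∀ x → f x ≤ g x) → ∑ xs f ≤ ∑ xs g
  ∑-mono []       f≤g = z≤n
  ∑-mono (x ∷ xs) f≤g = +-mono-≤ (f≤g x) (∑-mono xs f≤g)

  ∑-+ : ∀ xs (f g : A → ℕ) → ∑[ x ← xs ] (f x + g x) ≡ ∑ xs f + ∑ xs g
  ∑-+ []       f g = refl
  ∑-+ (x ∷ xs) f g = trans (cong (f x + g x +_) (∑-+ xs f g)) (+-interchange (f x) (g x) _ _)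

  ∑-*ˡ : ∀ xs c (f : A → ℕ) → ∑[ x ← xs ] (c * f x) ≡ c * ∑ xs f
  ∑-*ˡ []       c f = sym (*-zeroʳ c)
  ∑-*ˡ (x ∷ xs) c f = trans (cong (c * f x +_) (∑-*ˡ xs c f)) (sym (*-distribˡ-+ c (f x) (∑ xs f)))

  ∑-*ʳ : ∀ xs c (f : A → ℕ) → ∑[ x ← xs ] (f x * c) ≡ ∑ xs f * c
  ∑-*ʳ xs c f = trans (∑-cong xs (λ x → *-comm (f x) c)) (trans (∑-*ˡ xs c f) (*-comm c (∑ xs f)))

  ∑-zero : ∀ xs (f : A → ℕ) → (∀ x → x ∈ xs → f x ≡ 0) → ∑ xs f ≡ 0
  ∑-zero []       f f≡0 = refl
  ∑-zero (x ∷ xs) f f≡0 = cong₂ _+_ (f≡0 x (here refl)) (∑-zero xs f (λ y y∈ → f≡0 y (there y∈)))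

  ∑-++ : ∀ xs ys (f : A → ℕ) → ∑ (xs ++ ys) f ≡ ∑ xs f + ∑ ys f
  ∑-++ []       ys f = refl
  ∑-++ (x ∷ xs) ys f = trans (cong (f x +_) (∑-++ xs ys f)) (sym (+-assoc (f x) _ _))

  ∑-const : ∀ xs c → ∑[ _ ← xs ] c ≡ length xs * c
  ∑-const []       c = refl
  ∑-const (x ∷ xs) c = cong (c +_) (∑-const xs c)

  count-∧ˡ : ∀ xs b (p : A → Bool) → ∑[ x ← xs ] 𝟙 (b ∧ p x) ≡ 𝟙 b * count p xs
  count-∧ˡ xs b p = trans (∑-cong xs (λ x → 𝟙-∧ b (p x))) (∑-*ˡ xs (𝟙 b) (λ x → 𝟙 (p x)))

  count-mono : ∀ xs {p q : A → Bool} → (∀ x → p x ≡ true → q x ≡ true) → count p xs ≤ count q xs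
  count-mono xs {p} {q} p⇒q = ∑-mono xs 𝟙-mono
    where
    𝟙-mono : ∀ x → 𝟙 (p x) ≤ 𝟙 (q x)
    𝟙-mono x with p x in px
    ... | false = z≤n
    ... | true rewrite p⇒q x px = ≤-refl

  count-≥1 : ∀ {xs} (p : A → Bool) {x} → x ∈ xs → p x ≡ true → 1 ≤ count p xs
  count-≥1 p (here refl) px rewrite px = s≤s z≤n
  count-≥1 {y ∷ xs} p (there x∈) px = ≤-trans (count-≥1 p x∈ px) (m≤n+m _ (𝟙 (p y)))

  count-unique-≤1 : ∀ {xs} (p : A → Bool) → Unique xs →
                    (∀ x y → p x ≡ true → p y ≡ true → x ≡ y) → count p xs ≤ 1
  count-unique-≤1 {[]}     p []           p-unique = z≤n
  count-unique-≤1 {x ∷ xs} p (x∉xs ∷ uxs) p-unique with p x in px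
  ... | false = count-unique-≤1 p uxs p-unique
  ... | true  = s≤s (≤-reflexive (∑-zero xs _ no-other))
    where
    no-other : ∀ y → y ∈ xs → 𝟙 (p y) ≡ 0
    no-other y y∈ with p y in py
    ... | false = refl
    ... | true  = ⊥-elim (All¬⇒¬Any x∉xs (subst (_∈ xs) (sym (p-unique x y px py)) y∈))

  length-filter≡count : ∀ {p} {P : Pred A p} (P? : Decidable P) xs →
                        length (filter P? xs) ≡ count (λ x → does (P? x)) xs
  length-filter≡count P? [] = refl
  length-filter≡count P? (x ∷ xs) with does (P? x)
  ... | true  = cong suc (length-filter≡count P? xs)
  ... | false = length-filter≡count P? xs

  sum-map≡∑ : ∀ xs (f : A → ℕ) → sum (map f xs) ≡ ∑ xs f
  sum-map≡∑ []       f = refl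
  sum-map≡∑ (x ∷ xs) f = cong (f x +_) (sum-map≡∑ xs f)

module _ {a b} {A : Set a} {B : Set b} where

  ∑-map : ∀ xs (g : A → B) (f : B → ℕ) → ∑ (map g xs) f ≡ ∑[ x ← xs ] f (g x)
  ∑-map []       g f = refl
  ∑-map (x ∷ xs) g f = cong (f (g x) +_) (∑-map xs g f)

  ∑-concatMap : ∀ xs (g : A → List B) (f : B → ℕ) → ∑ (concatMap g xs) f ≡ ∑[ x ← xs ] ∑ (g x) f
  ∑-concatMap []       g f = refl
  ∑-concatMap (x ∷ xs) g f = trans (∑-++ (g x) (concatMap g xs) f) (cong (∑ (g x) f +_) (∑-concatMap xs g f))

  ∑-swap : ∀ xs ys (h : A → B → ℕ) →
           ∑[ x ← xs ] ∑[ y ← ys ] h x y ≡ ∑[ y ← ys ] ∑[ x ← xs ] h x y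
  ∑-swap []       ys h = sym (∑-zero ys _ (λ _ _ → refl))
  ∑-swap (x ∷ xs) ys h = trans (cong (∑ ys (h x) +_) (∑-swap xs ys h)) (sym (∑-+ ys (h x) _))

-- Degrees and rainbow paths in properly coloured graphs

module MaybeMembership {d} {D : Set d} (_≟_ : DecidableEquality D) where
  open import Data.List.Membership.DecPropositional _≟_ using (_∈?_)

  _∈ᵐ?_ : Maybe D → List D → Bool
  nothing ∈ᵐ? B = false
  just x  ∈ᵐ? B = does (x ∈? B)

  ∈ᵐ?-∷ : ∀ m b B → 𝟙 (m ∈ᵐ? (b ∷ B)) ≤ 𝟙 (m ∈ᵐ? [ b ]) + 𝟙 (m ∈ᵐ? B)
  ∈ᵐ?-∷ nothing  b B = z≤n
  ∈ᵐ?-∷ (just x) b B with x ≟ b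
  ... | yes _ = s≤s z≤n
  ... | no _  = ≤-refl

  ∈ᵐ?⇒ : ∀ m B → (m ∈ᵐ? B) ≡ true → ∃[ x ] (m ≡ just x × x ∈ B)
  ∈ᵐ?⇒ nothing  B ()
  ∈ᵐ?⇒ (just x) B e with x ∈? B
  ... | yes x∈B = x , refl , x∈B
  ∈ᵐ?⇒ (just x) B () | no _

  PartialInjective : ∀ {n} → (Fin n → Maybe D) → Set d
  PartialInjective h = ∀ y y′ {x} → h y ≡ just x → h y′ ≡ just x → y ≡ y′

  count-∈ᵐ?≤length : ∀ {n} (h : Fin n → Maybe D) → PartialInjective h →
                     ∀ B → count (λ y → h y ∈ᵐ? B) (allFin n) ≤ length B
  count-∈ᵐ?≤length {n} h h-inj [] = ≤-reflexive (∑-zero (allFin n) _ none)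
    where
    none : ∀ y → y ∈ allFin n → 𝟙 (h y ∈ᵐ? []) ≡ 0
    none y _ with h y
    ... | nothing = refl
    ... | just _  = refl
  count-∈ᵐ?≤length {n} h h-inj (b ∷ B) = begin
    count (λ y → h y ∈ᵐ? (b ∷ B)) (allFin n)
      ≤⟨ ∑-mono (allFin n) (λ y → ∈ᵐ?-∷ (h y) b B) ⟩
    ∑[ y ← allFin n ] (𝟙 (h y ∈ᵐ? [ b ]) + 𝟙 (h y ∈ᵐ? B))
      ≡⟨ ∑-+ (allFin n) _ _ ⟩
    count (λ y → h y ∈ᵐ? [ b ]) (allFin n) + count (λ y → h y ∈ᵐ? B) (allFin n)
      ≤⟨ +-mono-≤ (count-unique-≤1 _ (allFin⁺ n) hits-b-unique) (count-∈ᵐ?≤length h h-inj B) ⟩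
    1 + length B ∎
    where
    open ≤-Reasoning
    hits-b-unique : ∀ y y′ → (h y ∈ᵐ? [ b ]) ≡ true → (h y′ ∈ᵐ? [ b ]) ≡ true → y ≡ y′
    hits-b-unique y y′ e e′ with ∈ᵐ?⇒ (h y) [ b ] e | ∈ᵐ?⇒ (h y′) [ b ] e′
    ... | x , hy , here refl | x′ , hy′ , here refl = h-inj y y′ hy hy′

  ∈ᵐ?-just : ∀ {x B} → x ∈ B → (just x ∈ᵐ? B) ≡ true
  ∈ᵐ?-just {x} {B} x∈B = dec-true (x ∈? B) x∈B

module _ {n : ℕ} (G : ColGraph n) where

  adj : Fin n → Fin n → Bool
  adj u v = is-just (col G u v)

  degree : Fin n → ℕ
  degree x = count (adj x) (allFin n)

  adj-sym : ∀ u v → adj u v ≡ adj v u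
  adj-sym u v = cong is-just (col-sym G u v)

  adj⇒col : ∀ u v → adj u v ≡ true → ∃[ c ] col G u v ≡ just c
  adj⇒col u v _ with col G u v
  ... | just c = c , refl

  count-covered≤ : Proper G → ∀ x (P : Fin n → Bool) (A : List (Fin n)) (B : List ℕ) →
                   (∀ y → P y ≡ true → y ∈ A ⊎ ∃[ c ] (col G x y ≡ just c × c ∈ B)) →
                   count P (allFin n) ≤ length A + length B
  count-covered≤ proper x P A B covered = begin
    count P (allFin n)
      ≤⟨ ∑-mono (allFin n) 𝟙-covered ⟩
    ∑[ y ← allFin n ] (𝟙 (just y V.∈ᵐ? A) + 𝟙 (col G x y C.∈ᵐ? B))
      ≡⟨ ∑-+ (allFin n) _ _ ⟩
    count (λ y → just y V.∈ᵐ? A) (allFin n) + count (λ y → col G x y C.∈ᵐ? B) (allFin n)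
      ≤⟨ +-mono-≤ (V.count-∈ᵐ?≤length just (λ { y y′ refl refl → refl }) A)
                  (C.count-∈ᵐ?≤length (col G x) (λ y y′ → proper x y y′ _) B) ⟩
    length A + length B ∎
    where
    open ≤-Reasoning
    module V = MaybeMembership (Finₚ._≟_ {n})
    module C = MaybeMembership _≟_
    𝟙-covered : ∀ y → 𝟙 (P y) ≤ 𝟙 (just y V.∈ᵐ? A) + 𝟙 (col G x y C.∈ᵐ? B)
    𝟙-covered y with P y in Py
    ... | false = z≤n
    ... | true with covered y Py
    ...   | inj₁ y∈A rewrite V.∈ᵐ?-just y∈A = s≤s z≤n
    ...   | inj₂ (c , xy≡c , c∈B) rewrite xy≡c | C.∈ᵐ?-just c∈B = m≤n+m 1 _

module _ {n : ℕ} (G : ColGraph n) where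

  walkColours-length : ∀ v vs {cs} → walkColours G (v ∷ vs) ≡ just cs → length vs ≡ length cs
  walkColours-length v []       refl = refl
  walkColours-length v (w ∷ vs) wk with col G v w | walkColours G (w ∷ vs) in wk′
  walkColours-length v (w ∷ vs) refl | just c | just cs = cong suc (walkColours-length w vs wk′)

  walkColours-∷⁻ : ∀ u v rest {cs} → walkColours G (u ∷ v ∷ rest) ≡ just cs →
                   ∃₂ λ c cs′ → col G u v ≡ just c ×
                                walkColours G (v ∷ rest) ≡ just cs′ × cs ≡ c ∷ cs′
  walkColours-∷⁻ u v rest wk with col G u v | walkColours G (v ∷ rest)
  walkColours-∷⁻ u v rest refl | just c | just cs′ = c , cs′ , refl , refl , refl

  walkColours-∷⁺ : ∀ u v rest {c cs} → col G u v ≡ just c → walkColours G (v ∷ rest) ≡ just cs →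
                   walkColours G (u ∷ v ∷ rest) ≡ just (c ∷ cs)
  walkColours-∷⁺ u v rest uv wk rewrite uv | wk = refl

  walkColours-++⁺ : ∀ xs y ys {as bs} → walkColours G (xs ++ [ y ]) ≡ just as →
                    walkColours G (y ∷ ys) ≡ just bs → walkColours G (xs ++ y ∷ ys) ≡ just (as ++ bs)
  walkColours-++⁺ []            y ys refl wk = wk
  walkColours-++⁺ (x ∷ [])      y ys wx  wk with walkColours-∷⁻ x y [] wx
  ... | c , _ , xy , refl , refl = walkColours-∷⁺ x y ys xy wk
  walkColours-++⁺ (x ∷ x′ ∷ xs) y ys wx  wk with walkColours-∷⁻ x x′ (xs ++ [ y ]) wx
  ... | c , _ , xx′ , wx′ , refl =
    walkColours-∷⁺ x x′ (xs ++ y ∷ ys) xx′ (walkColours-++⁺ (x′ ∷ xs) y ys wx′ wk)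

  walkColours-∷ʳ⁻ : ∀ u vs z {cs} → walkColours G (u ∷ vs ++ [ z ]) ≡ just cs →
                    ∃₂ λ cs′ c → walkColours G (u ∷ vs) ≡ just cs′ × cs ≡ cs′ ++ [ c ]
  walkColours-∷ʳ⁻ u []       z wk with walkColours-∷⁻ u z [] wk
  ... | c , _ , _ , refl , refl = [] , c , refl , refl
  walkColours-∷ʳ⁻ u (v ∷ vs) z wk with walkColours-∷⁻ u v (vs ++ [ z ]) wk
  ... | c , _ , uv , wk′ , refl with walkColours-∷ʳ⁻ v vs z wk′
  ...   | cs′ , c′ , wk″ , refl = c ∷ cs′ , c′ , walkColours-∷⁺ u v vs uv wk″ , refl

degreeIn : ∀ {n} → ColGraph n → (Fin n → Bool) → Fin n → ℕ
degreeIn {n} G s x = count (λ y → s y ∧ adj G x y) (allFin n)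

module _ {n : ℕ} (G : ColGraph n) (proper : Proper G) (s : Fin n → Bool) where
  open import Data.List.Membership.DecPropositional (Finₚ._≟_ {n}) using () renaming (_∈?_ to _∈ⱽ?_)
  open import Data.List.Membership.DecPropositional _≟_ using () renaming (_∈?_ to _∈ᶜ?_)

  Extends : Fin n → List (Fin n) → List ℕ → Fin n → Set
  Extends x vs cs y = s y ≡ true × y ∉ vs × ∃[ c ] (col G x y ≡ just c × c ∉ cs)

  extends? : ∀ x vs cs y → Dec (Extends x vs cs y)
  extends? x vs cs y = (s y Boolₚ.≟ true) ×-dec (¬? (y ∈ⱽ? vs) ×-dec fresh? (col G x y))
    where
    fresh? : ∀ m → Dec (∃[ c ] (m ≡ just c × c ∉ cs))
    fresh? nothing  = no λ { (_ , () , _) }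
    fresh? (just c) with c ∈ᶜ? cs
    ... | yes c∈ = no λ { (_ , refl , c∉) → c∉ c∈ }
    ... | no c∉  = yes (c , refl , c∉)

  degreeIn≤-unless-extends : ∀ x vs cs → ¬ ∃ (Extends x vs cs) → degreeIn G s x ≤ length vs + length cs
  degreeIn≤-unless-extends x vs cs ¬ext = count-covered≤ G proper x _ vs cs covered
    where
    covered : ∀ y → (s y ∧ adj G x y) ≡ true → y ∈ vs ⊎ ∃[ c ] (col G x y ≡ just c × c ∈ cs)
    covered y syxy with ∧≡true⁻ (s y) syxy
    ... | sy , xy with y ∈ⱽ? vs | adj⇒col G x y xy
    ...   | yes y∈ | _ = inj₁ y∈
    ...   | no y∉  | c , xy≡c with c ∈ᶜ? cs
    ...     | yes c∈ = inj₂ (c , xy≡c , c∈)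
    ...     | no c∉  = ⊥-elim (¬ext (y , sy , y∉ , c , xy≡c , c∉))

  module _ {ℓ : ℕ} (minDegree : ∀ v → s v ≡ true → 2 * ℓ ≤ degreeIn G s v) where

    -- The path grows at its head, which therefore always lies in s.
    rainbowPaths-in : ∀ v → s v ≡ true → ∀ j → j ≤ ℓ →
                      ∃₂ λ x vs → RainbowPathSeq G j (x ∷ vs) × s x ≡ true
    rainbowPaths-in v sv zero    _   = v , [] , (refl , [] ∷ [] , [] , refl , []) , sv
    rainbowPaths-in v sv (suc j) j<ℓ
      with rainbowPaths-in v sv j (<⇒≤ j<ℓ)
    ... | x , vs , (len , u , cs , wk , ucs) , sx
      with Finₚ.any? (extends? x (x ∷ vs) cs)
    ... | yes (y , sy , y∉ , c , xy≡c , c∉) =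
      y , x ∷ vs ,
      (cong suc len , ¬Any⇒All¬ _ y∉ ∷ u ,
       c ∷ cs , walkColours-∷⁺ G y x vs (trans (col-sym G y x) xy≡c) wk , ¬Any⇒All¬ _ c∉ ∷ ucs) ,
      sy
    ... | no ¬ext = ⊥-elim (<⇒≱ degree<2ℓ (minDegree x sx))
      where
      |cs|≡j : length cs ≡ j
      |cs|≡j = trans (sym (walkColours-length G x vs wk)) (suc-injective len)
      degree<2ℓ : degreeIn G s x < 2 * ℓ
      degree<2ℓ = begin-strict
        degreeIn G s x              ≤⟨ degreeIn≤-unless-extends x (x ∷ vs) cs ¬ext ⟩
        suc (length vs) + length cs ≡⟨ cong₂ _+_ len |cs|≡j ⟩
        suc j + j                   <⟨ +-monoʳ-< (suc j) (n<1+n j) ⟩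
        suc j + suc j               ≡⟨ cong (suc j +_) (sym (+-identityʳ (suc j))) ⟩
        2 * suc j                   ≤⟨ *-monoʳ-≤ 2 j<ℓ ⟩
        2 * ℓ                       ∎
        where open ≤-Reasoning

    rainbowPath-of-minDegree : ∀ v → s v ≡ true → HasRainbowPath G ℓ
    rainbowPath-of-minDegree v sv with rainbowPaths-in v sv ℓ ≤-refl
    ... | x , vs , path , _ = x ∷ vs , path

-- Rainbow cycles

Unique-rotate : ∀ {a} {A : Set a} {v : A} {L} → Unique (v ∷ L) → Unique (L ++ [ v ])
Unique-rotate (v∉L ∷ uL) = ++⁺ uL ([] ∷ []) λ { (w∈L , here refl) → All¬⇒¬Any v∉L w∈L }

Unique-++⁻ˡ : ∀ {a} {A : Set a} (xs : List A) {ys} → Unique (xs ++ ys) → Unique xs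
Unique-++⁻ˡ []       _           = []
Unique-++⁻ˡ (x ∷ xs) (x∉ ∷ uxs) = ++⁻ˡ xs x∉ ∷ Unique-++⁻ˡ xs uxs

module _ {n : ℕ} (G : ColGraph n) {ℓ : ℕ} where

  rainbowCycle-rotate : ∀ v L → RainbowCycleSeq G ℓ (v ∷ L) → RainbowCycleSeq G ℓ (L ++ [ v ])
  rainbowCycle-rotate v []       h = h
  rainbowCycle-rotate v (w ∷ ws) (len , u , cs , wk , ucs) with walkColours-∷⁻ G v w (ws ++ [ v ]) wk
  ... | c , cs′ , vw , wk′ , refl =
    trans (cong suc (trans (length-++ ws) (+-comm (length ws) 1))) len ,
    Unique-rotate u ,
    cs′ ++ [ c ] ,
    subst (λ vs → walkColours G vs ≡ just (cs′ ++ [ c ])) (sym (++-assoc (w ∷ ws) [ v ] [ w ]))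
          (walkColours-++⁺ G (w ∷ ws) v [ w ] wk′ (walkColours-∷⁺ G v w [] vw refl)) ,
    Unique-rotate ucs

  rainbowCycle-rotateTo : ∀ pre x post → RainbowCycleSeq G ℓ (pre ++ x ∷ post) →
                          RainbowCycleSeq G ℓ (x ∷ post ++ pre)
  rainbowCycle-rotateTo []        x post h = subst (RainbowCycleSeq G ℓ) (cong (x ∷_) (sym (++-identityʳ post))) h
  rainbowCycle-rotateTo (p ∷ pre) x post h =
    subst (RainbowCycleSeq G ℓ) (cong (x ∷_) (++-assoc post [ p ] pre))
      (rainbowCycle-rotateTo pre x (post ++ [ p ])
        (subst (RainbowCycleSeq G ℓ) (++-assoc pre (x ∷ post) [ p ])
          (rainbowCycle-rotate p (pre ++ x ∷ post) h)))

2*[2+k]∸3 : ∀ k → 2 * (2 + k) ∸ 3 ≡ suc k + k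
2*[2+k]∸3 k = begin
  2 * (2 + k) ∸ 3 ≡⟨ cong (_∸ 3) (*-distribˡ-+ 2 2 k) ⟩
  1 + 2 * k       ≡⟨ cong (λ m → suc (k + m)) (+-identityʳ k) ⟩
  suc k + k       ∎
  where open ≡-Reasoning

module _ {n : ℕ} {G : ColGraph n} (proper : Proper G) {ℓ : ℕ} (noPath : ¬ HasRainbowPath G ℓ) where

  degree-cycle-head≤ : ∀ x v vs → RainbowCycleSeq G ℓ (x ∷ v ∷ vs) → degree G x ≤ suc (length vs) + length vs
  degree-cycle-head≤ x v vs (len , u , cs , wk , ucs) with walkColours-∷ʳ⁻ G x (v ∷ vs) x wk
  ... | _ , _ , wk′ , refl with walkColours-∷⁻ G x v vs wk′
  ...   | c₀ , B , xv , wB , refl with Finₚ.any? (extends? G proper (λ _ → true) x (v ∷ vs) B)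
  ...     | no ¬ext =
    subst (λ m → degree G x ≤ suc (length vs) + m) (sym (walkColours-length G v vs wB))
          (degreeIn≤-unless-extends G proper (λ _ → true) x (v ∷ vs) B ¬ext)
  ...     | yes (y , _ , y∉ , c , xy≡c , c∉B) =
    ⊥-elim (noPath (y ∷ x ∷ v ∷ vs , cong suc len , (y≢x ∷ ¬Any⇒All¬ _ y∉) ∷ u ,
                    c ∷ c₀ ∷ B , walkColours-∷⁺ G y x (v ∷ vs) (trans (col-sym G y x) xy≡c) wk′ ,
                    (c≢c₀ ∷ ¬Any⇒All¬ _ c∉B) ∷ Unique-++⁻ˡ (c₀ ∷ B) ucs))
    where
    y≢x : ¬ y ≡ x
    y≢x refl with trans (sym xy≡c) (irrefl G y)
    ... | ()
    c≢c₀ : ¬ c ≡ c₀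
    c≢c₀ refl = y∉ (here (proper x y v c xy≡c xv))

  degree-on-rainbowCycle≤ : ∀ {L x} → RainbowCycleSeq G ℓ L → x ∈ L → degree G x ≤ 2 * ℓ ∸ 3
  degree-on-rainbowCycle≤ {x = x} h x∈L with ∈-∃++ x∈L
  ... | pre , post , refl = from-head (post ++ pre) (rainbowCycle-rotateTo G pre x post h)
    where
    from-head : ∀ rest → RainbowCycleSeq G ℓ (x ∷ rest) → degree G x ≤ 2 * ℓ ∸ 3
    from-head [] (_ , _ , _ , wk , _) with col G x x | irrefl G x
    from-head [] (_ , _ , _ , () , _) | .nothing | refl
    from-head (v ∷ vs) h@(len , _) =
      subst (λ k → degree G x ≤ 2 * k ∸ 3) len
        (subst (degree G x ≤_) (sym (2*[2+k]∸3 (length vs))) (degree-cycle-head≤ x v vs h))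

-- ex*(n, P_ℓ) ≤ 2ℓn by peeling

module _ {n : ℕ} where

  _==_ : Fin n → Fin n → Bool
  u == v = does (u Finₚ.≟ v)

  _≺_ : Fin n → Fin n → Bool
  u ≺ v = does (toℕ u <? toℕ v)

  _∖_ : (Fin n → Bool) → Fin n → Fin n → Bool
  (s ∖ v) u = s u ∧ not (u == v)

  size : (Fin n → Bool) → ℕ
  size s = count s (allFin n)

  count-== : ∀ v → count (_== v) (allFin n) ≡ 1
  count-== v = ≤-antisym (count-unique-≤1 (_== v) (allFin⁺ n) ==-unique)
                         (count-≥1 (_== v) (∈-allFin v) (dec-true (v Finₚ.≟ v) refl))
    where
    ==-unique : ∀ x y → (x == v) ≡ true → (y == v) ≡ true → x ≡ y
    ==-unique x y _ _ with x Finₚ.≟ v | y Finₚ.≟ v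
    ... | yes refl | yes refl = refl

  ∑-𝟙-==-∧ : ∀ v c → ∑[ u ← allFin n ] 𝟙 (u == v ∧ c) ≡ 𝟙 c
  ∑-𝟙-==-∧ v c = begin
    ∑[ u ← allFin n ] 𝟙 (u == v ∧ c)   ≡⟨ ∑-cong (allFin n) (λ u → 𝟙-∧ (u == v) c) ⟩
    ∑[ u ← allFin n ] (𝟙 (u == v) * 𝟙 c) ≡⟨ ∑-*ʳ (allFin n) (𝟙 c) (λ u → 𝟙 (u == v)) ⟩
    count (_== v) (allFin n) * 𝟙 c     ≡⟨ cong (_* 𝟙 c) (count-== v) ⟩
    1 * 𝟙 c                            ≡⟨ *-identityˡ (𝟙 c) ⟩
    𝟙 c                                ∎
    where open ≡-Reasoning

  size-∖ : ∀ s v → s v ≡ true → size s ≡ suc (size (s ∖ v))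
  size-∖ s v sv = begin
    size s                                              ≡⟨ ∑-cong (allFin n) split ⟩
    ∑[ u ← allFin n ] (𝟙 ((s ∖ v) u) + 𝟙 (u == v))      ≡⟨ ∑-+ (allFin n) _ _ ⟩
    size (s ∖ v) + count (_== v) (allFin n)             ≡⟨ cong (size (s ∖ v) +_) (count-== v) ⟩
    size (s ∖ v) + 1                                    ≡⟨ +-comm _ 1 ⟩
    suc (size (s ∖ v))                                  ∎
    where
    open ≡-Reasoning
    split : ∀ u → 𝟙 (s u) ≡ 𝟙 ((s ∖ v) u) + 𝟙 (u == v)
    split u with u Finₚ.≟ v
    ... | yes refl rewrite sv = refl
    ... | no _ with s u
    ...   | true  = refl
    ...   | false = refl

module _ {n : ℕ} (G : ColGraph n) where

  edgeEnds : (Fin n → Bool) → ℕ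
  edgeEnds s = ∑[ u ← allFin n ] ∑[ w ← allFin n ] 𝟙 (s u ∧ (s w ∧ adj G u w))

  edgeEnds-∖ : ∀ s v → s v ≡ true → edgeEnds s ≡ edgeEnds (s ∖ v) + (degreeIn G s v + degreeIn G s v)
  edgeEnds-∖ s v sv = begin
    edgeEnds s
      ≡⟨ ∑-cong V (λ u → ∑-cong V (split u)) ⟩
    ∑[ u ← V ] ∑[ w ← V ] (inside u w + (at-u u w + at-w u w))
      ≡⟨ ∑∑-+ inside (λ u w → at-u u w + at-w u w) ⟩
    edgeEnds (s ∖ v) + ∑[ u ← V ] ∑[ w ← V ] (at-u u w + at-w u w)
      ≡⟨ cong (edgeEnds (s ∖ v) +_) (∑∑-+ at-u at-w) ⟩
    edgeEnds (s ∖ v) + (∑[ u ← V ] ∑[ w ← V ] at-u u w + ∑[ u ← V ] ∑[ w ← V ] at-w u w)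
      ≡⟨ cong (edgeEnds (s ∖ v) +_) (cong₂ _+_ sum-at-u sum-at-w) ⟩
    edgeEnds (s ∖ v) + (degreeIn G s v + degreeIn G s v)
      ∎
    where
    open ≡-Reasoning
    V = allFin n
    inside at-u at-w : Fin n → Fin n → ℕ
    inside u w = 𝟙 ((s ∖ v) u ∧ ((s ∖ v) w ∧ adj G u w))
    at-u u w = 𝟙 (u == v ∧ (s w ∧ adj G v w))
    at-w u w = 𝟙 (w == v ∧ (s u ∧ adj G u v))

    split : ∀ u w → 𝟙 (s u ∧ (s w ∧ adj G u w)) ≡ inside u w + (at-u u w + at-w u w)
    split u w with u Finₚ.≟ v | w Finₚ.≟ v
    ... | yes refl | yes refl rewrite sv | irrefl G u = refl
    ... | yes refl | no _     rewrite sv = sym (+-identityʳ _)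
    ... | no _     | yes refl rewrite sv with s u
    ...   | true  = refl
    ...   | false = refl
    split u w | no _ | no _ with s u | s w
    ... | true  | true  = sym (+-identityʳ _)
    ... | true  | false = refl
    ... | false | _     = refl

    ∑∑-+ : ∀ (f g : Fin n → Fin n → ℕ) →
           ∑[ u ← V ] ∑[ w ← V ] (f u w + g u w)
           ≡ ∑[ u ← V ] ∑[ w ← V ] f u w + ∑[ u ← V ] ∑[ w ← V ] g u w
    ∑∑-+ f g = trans (∑-cong V (λ u → ∑-+ V (f u) (g u)))
                     (∑-+ V (λ u → ∑ V (f u)) (λ u → ∑ V (g u)))

    sum-at-u : ∑[ u ← V ] ∑[ w ← V ] at-u u w ≡ degreeIn G s v
    sum-at-u = trans (∑-swap V V at-u) (∑-cong V (λ w → ∑-𝟙-==-∧ v (s w ∧ adj G v w)))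

    sum-at-w : ∑[ u ← V ] ∑[ w ← V ] at-w u w ≡ degreeIn G s v
    sum-at-w = ∑-cong V (λ u → trans (∑-𝟙-==-∧ v (s u ∧ adj G u v))
                                     (cong (λ b → 𝟙 (s u ∧ b)) (adj-sym G u v)))

module _ {n : ℕ} {G : ColGraph n} (proper : Proper G) {ℓ : ℕ} (noPath : ¬ HasRainbowPath G ℓ) where

  edgeEnds≤ : ∀ k s → size s ≡ k → edgeEnds G s ≤ (2 * ℓ + 2 * ℓ) * k
  edgeEnds≤ k s |s|≡k with Finₚ.any? (λ v → (s v Boolₚ.≟ true) ×-dec (degreeIn G s v <? 2 * ℓ))
  edgeEnds≤ zero    s |s|≡0 | yes (v , sv , _) =
    ⊥-elim (1+n≰n (subst (1 ≤_) |s|≡0 (count-≥1 s (∈-allFin v) sv)))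
  edgeEnds≤ (suc k) s |s|≡1+k | yes (v , sv , low) = begin
    edgeEnds G s                                            ≡⟨ edgeEnds-∖ G s v sv ⟩
    edgeEnds G (s ∖ v) + (degreeIn G s v + degreeIn G s v)  ≤⟨ +-mono-≤ (edgeEnds≤ k (s ∖ v) |s∖v|≡k)
                                                                         (+-mono-≤ (<⇒≤ low) (<⇒≤ low)) ⟩
    (2 * ℓ + 2 * ℓ) * k + (2 * ℓ + 2 * ℓ)                   ≡⟨ +-comm _ (2 * ℓ + 2 * ℓ) ⟩
    (2 * ℓ + 2 * ℓ) + (2 * ℓ + 2 * ℓ) * k                   ≡⟨ *-suc (2 * ℓ + 2 * ℓ) k ⟨
    (2 * ℓ + 2 * ℓ) * suc k                                 ∎
    where
    open ≤-Reasoning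
    |s∖v|≡k : size (s ∖ v) ≡ k
    |s∖v|≡k = suc-injective (trans (sym (size-∖ s v sv)) |s|≡1+k)
  edgeEnds≤ k s _ | no ¬low with Finₚ.any? (λ v → s v Boolₚ.≟ true)
  ... | yes (v , sv) = ⊥-elim (noPath (rainbowPath-of-minDegree G proper s highDegree v sv))
    where
    highDegree : ∀ u → s u ≡ true → 2 * ℓ ≤ degreeIn G s u
    highDegree u su = ≮⇒≥ (λ low → ¬low (u , su , low))
  ... | no ¬any = ≤-trans (≤-reflexive (∑-zero (allFin n) _ (λ u _ → no-edge-at u))) z≤n
    where
    no-edge-at : ∀ u → ∑[ w ← allFin n ] 𝟙 (s u ∧ (s w ∧ adj G u w)) ≡ 0
    no-edge-at u rewrite Boolₚ.¬-not (λ su → ¬any (u , su)) = ∑-zero (allFin n) _ (λ _ _ → refl)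

  degreeSum≤ : ∑[ u ← allFin n ] degree G u ≤ (2 * ℓ + 2 * ℓ) * n
  degreeSum≤ = subst (λ k → edgeEnds G (λ _ → true) ≤ (2 * ℓ + 2 * ℓ) * k) |V|≡n
                     (edgeEnds≤ _ (λ _ → true) refl)
    where
    |V|≡n : size {n} (λ _ → true) ≡ n
    |V|≡n = trans (∑-const (allFin n) 1) (trans (*-identityʳ _) (length-tabulate (λ i → i)))

module _ {n : ℕ} (G : ColGraph n) where

  edgeCount≡∑ : edgeCount G ≡ ∑[ u ← allFin n ] count (λ v → u ≺ v ∧ adj G u v) (allFin n)
  edgeCount≡∑ = trans (sum-map≡∑ (allFin n) _)
                      (∑-cong (allFin n) (λ u → length-filter≡count _ (allFin n)))

  𝟙-adj-split : ∀ u v → 𝟙 (adj G u v) ≡ 𝟙 (u ≺ v ∧ adj G u v) + 𝟙 (v ≺ u ∧ adj G v u)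
  𝟙-adj-split u v with <-cmp (toℕ u) (toℕ v)
  ... | tri< u<v _ _ rewrite dec-true (toℕ u <? toℕ v) u<v | dec-false (toℕ v <? toℕ u) (<-asym u<v) =
    sym (+-identityʳ _)
  ... | tri> _ _ v<u rewrite dec-false (toℕ u <? toℕ v) (<-asym v<u) | dec-true (toℕ v <? toℕ u) v<u =
    cong 𝟙 (adj-sym G u v)
  ... | tri≈ _ u≡v _ with Finₚ.toℕ-injective u≡v
  ...   | refl rewrite dec-false (toℕ u <? toℕ u) (<-irrefl refl) | irrefl G u = refl

  handshake : ∑[ u ← allFin n ] degree G u ≡ edgeCount G + edgeCount G
  handshake = begin
    ∑[ u ← V ] degree G u
      ≡⟨ ∑-cong V (λ u → trans (∑-cong V (𝟙-adj-split u)) (∑-+ V _ _)) ⟩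
    ∑[ u ← V ] (count (λ v → u ≺ v ∧ adj G u v) V + ∑[ v ← V ] 𝟙 (v ≺ u ∧ adj G v u))
      ≡⟨ ∑-+ V _ _ ⟩
    ∑[ u ← V ] count (λ v → u ≺ v ∧ adj G u v) V + ∑[ u ← V ] ∑[ v ← V ] 𝟙 (v ≺ u ∧ adj G v u)
      ≡⟨ cong (∑[ u ← V ] count (λ v → u ≺ v ∧ adj G u v) V +_)
              (∑-swap V V (λ u v → 𝟙 (v ≺ u ∧ adj G v u))) ⟩
    ∑[ u ← V ] count (λ v → u ≺ v ∧ adj G u v) V + ∑[ v ← V ] count (λ u → v ≺ u ∧ adj G v u) V
      ≡⟨ cong₂ _+_ edgeCount≡∑ edgeCount≡∑ ⟨
    edgeCount G + edgeCount G
      ∎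
    where
    open ≡-Reasoning
    V = allFin n

edgeCount≤ : ∀ {n} {G : ColGraph n} {ℓ} → Admissible ℓ G → edgeCount G ≤ 2 * ℓ * n
edgeCount≤ {n} {G} {ℓ} (proper , noPath) = *-cancelˡ-≤ 2 (begin
  2 * edgeCount G                ≡⟨ cong (edgeCount G +_) (+-identityʳ (edgeCount G)) ⟩
  edgeCount G + edgeCount G      ≡⟨ handshake G ⟨
  ∑[ u ← allFin n ] degree G u   ≤⟨ degreeSum≤ proper noPath ⟩
  (2 * ℓ + 2 * ℓ) * n            ≡⟨ cong (λ m → (2 * ℓ + m) * n) (sym (+-identityʳ (2 * ℓ))) ⟩
  2 * (2 * ℓ) * n                ≡⟨ *-assoc 2 (2 * ℓ) n ⟩
  2 * (2 * ℓ * n)                ∎)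
  where open ≤-Reasoning

-- Counting rainbow cycles

count-allLists-suc : ∀ {n} (p : List (Fin n) → Bool) j →
                     count p (allLists n (suc j)) ≡ ∑[ v ← allFin n ] count (λ vs → p (v ∷ vs)) (allLists n j)
count-allLists-suc {n} p j =
  trans (∑-concatMap (allFin n) (λ v → map (v ∷_) (allLists n j)) (λ vs → 𝟙 (p vs)))
        (∑-cong (allFin n) (λ v → ∑-map (allLists n j) (v ∷_) (λ vs → 𝟙 (p vs))))

module _ {n : ℕ} (G : ColGraph n) (D : ℕ) where

  lowWalk : Fin n → List (Fin n) → Bool
  lowWalk v []       = true
  lowWalk v (w ∷ vs) = does (degree G v ≤? D) ∧ (adj G v w ∧ lowWalk w vs)

  𝟙-low*degree≤ : ∀ v → 𝟙 (does (degree G v ≤? D)) * degree G v ≤ D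
  𝟙-low*degree≤ v with degree G v ≤? D
  ... | yes deg≤D rewrite dec-true (degree G v ≤? D) deg≤D = ≤-trans (≤-reflexive (+-identityʳ _)) deg≤D
  ... | no  deg≰D rewrite dec-false (degree G v ≤? D) deg≰D = z≤n

  count-lowWalk≤ : ∀ j v → count (lowWalk v) (allLists n j) ≤ D ^ j
  count-lowWalk≤ zero    v = ≤-refl
  count-lowWalk≤ (suc j) v = begin
    count (lowWalk v) (allLists n (suc j))
      ≡⟨ count-allLists-suc (lowWalk v) j ⟩
    ∑[ w ← V ] count (λ vs → low ∧ (adj G v w ∧ lowWalk w vs)) (allLists n j)
      ≡⟨ ∑-cong V (λ w → trans (count-∧ˡ (allLists n j) low _)
                                       (cong (𝟙 low *_) (count-∧ˡ (allLists n j) (adj G v w) (lowWalk w)))) ⟩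
    ∑[ w ← V ] (𝟙 low * (𝟙 (adj G v w) * count (lowWalk w) (allLists n j)))
      ≤⟨ ∑-mono V (λ w → *-monoʳ-≤ (𝟙 low) (*-monoʳ-≤ (𝟙 (adj G v w)) (count-lowWalk≤ j w))) ⟩
    ∑[ w ← V ] (𝟙 low * (𝟙 (adj G v w) * D ^ j))
      ≡⟨ trans (∑-*ˡ V (𝟙 low) _) (cong (𝟙 low *_) (∑-*ʳ V (D ^ j) (λ w → 𝟙 (adj G v w)))) ⟩
    𝟙 low * (degree G v * D ^ j)
      ≡⟨ *-assoc (𝟙 low) (degree G v) (D ^ j) ⟨
    𝟙 low * degree G v * D ^ j
      ≤⟨ *-monoˡ-≤ (D ^ j) (𝟙-low*degree≤ v) ⟩
    D * D ^ j
      ∎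
    where
    open ≤-Reasoning
    V = allFin n
    low = does (degree G v ≤? D)

  lowWalk-of-walkColours : ∀ v vs {cs} → walkColours G (v ∷ vs) ≡ just cs →
                           (∀ x → x ∈ v ∷ vs → degree G x ≤ D) → lowWalk v vs ≡ true
  lowWalk-of-walkColours v []       _  _   = refl
  lowWalk-of-walkColours v (w ∷ vs) wk low with walkColours-∷⁻ G v w vs wk
  ... | _ , _ , vw , wk′ , refl
    rewrite dec-true (degree G v ≤? D) (low v (here refl)) | vw =
    lowWalk-of-walkColours w vs wk′ (λ x x∈ → low x (there x∈))

module _ {n : ℕ} {G : ColGraph n} (proper : Proper G) {ℓ : ℕ} (noPath : ¬ HasRainbowPath G ℓ) where

  rainbowCycle⇒lowWalk : ∀ v₀ v₁ vs → RainbowCycleSeq G ℓ (v₀ ∷ v₁ ∷ vs) →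
                         (adj G v₀ v₁ ∧ lowWalk G (2 * ℓ ∸ 3) v₁ vs) ≡ true
  rainbowCycle⇒lowWalk v₀ v₁ vs h@(_ , _ , _ , wk , _) with walkColours-∷⁻ G v₀ v₁ (vs ++ [ v₀ ]) wk
  ... | _ , _ , v₀v₁ , wk′ , refl with walkColours-∷ʳ⁻ G v₁ vs v₀ wk′
  ...   | _ , _ , wk″ , refl =
    trans (cong (λ m → is-just m ∧ lowWalk G (2 * ℓ ∸ 3) v₁ vs) v₀v₁)
          (lowWalk-of-walkColours G _ v₁ vs wk″ (λ x x∈ → degree-on-rainbowCycle≤ proper noPath h (there x∈)))

  count-rainbowCycleSeq≤ : ∀ k → count (λ vs → does (rainbowCycleSeq? G ℓ vs)) (allLists n (2 + k))
                                  ≤ (edgeCount G + edgeCount G) * (2 * ℓ ∸ 3) ^ k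
  count-rainbowCycleSeq≤ k = begin
    count rc (allLists n (2 + k))
      ≡⟨ count-allLists-suc rc (suc k) ⟩
    ∑[ v₀ ← V ] count (λ vs → rc (v₀ ∷ vs)) (allLists n (suc k))
      ≡⟨ ∑-cong V (λ v₀ → count-allLists-suc (λ vs → rc (v₀ ∷ vs)) k) ⟩
    ∑[ v₀ ← V ] ∑[ v₁ ← V ] count (λ vs → rc (v₀ ∷ v₁ ∷ vs)) (allLists n k)
      ≤⟨ ∑-mono V (λ v₀ → ∑-mono V (λ v₁ → count-mono (allLists n k) (cycle⇒lowWalk v₀ v₁))) ⟩
    ∑[ v₀ ← V ] ∑[ v₁ ← V ] count (λ vs → adj G v₀ v₁ ∧ lowWalk G D v₁ vs) (allLists n k)
      ≡⟨ ∑-cong V (λ v₀ → ∑-cong V (λ v₁ →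
           count-∧ˡ (allLists n k) (adj G v₀ v₁) (lowWalk G D v₁))) ⟩
    ∑[ v₀ ← V ] ∑[ v₁ ← V ] (𝟙 (adj G v₀ v₁) * count (lowWalk G D v₁) (allLists n k))
      ≤⟨ ∑-mono V (λ v₀ → ∑-mono V (λ v₁ →
           *-monoʳ-≤ (𝟙 (adj G v₀ v₁)) (count-lowWalk≤ G D k v₁))) ⟩
    ∑[ v₀ ← V ] ∑[ v₁ ← V ] (𝟙 (adj G v₀ v₁) * D ^ k)
      ≡⟨ trans (∑-cong V (λ v₀ → ∑-*ʳ V (D ^ k) (λ v₁ → 𝟙 (adj G v₀ v₁))))
               (∑-*ʳ V (D ^ k) (degree G)) ⟩
    ∑[ v₀ ← V ] degree G v₀ * D ^ k
      ≡⟨ cong (_* D ^ k) (handshake G) ⟩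
    (edgeCount G + edgeCount G) * D ^ k
      ∎
    where
    open ≤-Reasoning
    V = allFin n
    D = 2 * ℓ ∸ 3
    rc : List (Fin n) → Bool
    rc vs = does (rainbowCycleSeq? G ℓ vs)
    cycle⇒lowWalk : ∀ v₀ v₁ vs → rc (v₀ ∷ v₁ ∷ vs) ≡ true → (adj G v₀ v₁ ∧ lowWalk G D v₁ vs) ≡ true
    cycle⇒lowWalk v₀ v₁ vs is-cycle =
      rainbowCycle⇒lowWalk v₀ v₁ vs (does-true⇒ (rainbowCycleSeq? G ℓ (v₀ ∷ v₁ ∷ vs)) is-cycle)

rainbowCycleCount≤ : ∀ {n} {G : ColGraph n} k → Admissible (2 + k) G →
                     rainbowCycleCount G (2 + k) ≤ (2 * (2 + k) ∸ 3) ^ k * edgeCount G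
rainbowCycleCount≤ {n} {G} k (proper , noPath) = begin
  rainbowCycleCount G ℓ       ≡⟨ cong (_/ (2 * ℓ)) (length-filter≡count (rainbowCycleSeq? G ℓ) (allLists n ℓ)) ⟩
  sequences / (2 * ℓ)         ≤⟨ /-monoʳ-≤ sequences (*-monoʳ-≤ 2 {1} {ℓ} (s≤s z≤n)) ⟩
  sequences / 2               ≤⟨ /-monoˡ-≤ 2 (≤-trans (count-rainbowCycleSeq≤ proper noPath k)
                                                       (≤-reflexive reorder)) ⟩
  K * edgeCount G * 2 / 2     ≡⟨ m*n/n≡m (K * edgeCount G) 2 ⟩
  K * edgeCount G             ∎
  where
  open ≤-Reasoning
  open +-*-Solver
  ℓ = 2 + k
  K = (2 * ℓ ∸ 3) ^ k
  sequences = count (λ vs → does (rainbowCycleSeq? G ℓ vs)) (allLists n ℓ)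
  reorder : (edgeCount G + edgeCount G) * K ≡ K * edgeCount G * 2
  reorder = solve 2 (λ e m → (e :+ e) :* m := m :* e :* con 2) refl (edgeCount G) K

-- Existence of the extremal numbers

record Relabelling {n} (G H : ColGraph n) (φ : ℕ → ℕ) : Set where
  constructor relabelling
  field recolours : ∀ u v → col H u v ≡ Maybe.map φ (col G u v)
open Relabelling

module _ {n : ℕ} {G H : ColGraph n} {φ : ℕ → ℕ} (G→H : Relabelling G H φ) where

  walkColours-relabel : ∀ vs → walkColours H vs ≡ Maybe.map (map φ) (walkColours G vs)
  walkColours-relabel []        = refl
  walkColours-relabel (_ ∷ [])  = refl
  walkColours-relabel (u ∷ v ∷ vs) =
    trans (cong₂ (λ m w → m >>= λ c → Maybe.map (c ∷_) w) (recolours G→H u v) (walkColours-relabel (v ∷ vs)))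
          (bind-map (col G u v) (walkColours G (v ∷ vs)))
    where
    bind-map : ∀ m w → (Maybe.map φ m >>= λ c → Maybe.map (c ∷_) (Maybe.map (map φ) w))
                       ≡ Maybe.map (map φ) (m >>= λ c → Maybe.map (c ∷_) w)
    bind-map nothing  _        = refl
    bind-map (just _) nothing  = refl
    bind-map (just _) (just _) = refl

  adj-relabel : ∀ u v → adj H u v ≡ adj G u v
  adj-relabel u v rewrite recolours G→H u v with col G u v
  ... | nothing = refl
  ... | just _  = refl

  edgeCount-relabel : edgeCount H ≡ edgeCount G
  edgeCount-relabel = begin
    edgeCount H
      ≡⟨ edgeCount≡∑ H ⟩
    ∑[ u ← allFin n ] count (λ v → u ≺ v ∧ adj H u v) (allFin n)
      ≡⟨ ∑-cong (allFin n) (λ u → ∑-cong (allFin n) (λ v → cong (λ b → 𝟙 (u ≺ v ∧ b)) (adj-relabel u v))) ⟩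
    ∑[ u ← allFin n ] count (λ v → u ≺ v ∧ adj G u v) (allFin n)
      ≡⟨ edgeCount≡∑ G ⟨
    edgeCount G
      ∎
    where open ≡-Reasoning

  proper-relabel⁻ : Proper H → Proper G
  proper-relabel⁻ proper u v w c uv uw =
    proper u v w (φ c) (trans (recolours G→H u v) (cong (Maybe.map φ) uv))
                       (trans (recolours G→H u w) (cong (Maybe.map φ) uw))

module _ {n : ℕ} {G H : ColGraph n} {φ ψ : ℕ → ℕ} (G→H : Relabelling G H φ) (H→G : Relabelling H G ψ) where

  -- ψ undoes φ on the colours of G, so φ keeps distinct colours of G distinct.
  rainbowWalk-relabel : ∀ {vs cs} → walkColours G vs ≡ just cs → Unique cs →
                        walkColours H vs ≡ just (map φ cs) × Unique (map φ cs)
  rainbowWalk-relabel {vs} {cs} wk ucs = wk′ , map⁻ (subst Unique cs≡ψφcs ucs)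
    where
    wk′ : walkColours H vs ≡ just (map φ cs)
    wk′ = trans (walkColours-relabel G→H vs) (cong (Maybe.map (map φ)) wk)
    cs≡ψφcs : cs ≡ map ψ (map φ cs)
    cs≡ψφcs = Maybeₚ.just-injective
      (trans (sym wk) (trans (walkColours-relabel H→G vs) (cong (Maybe.map (map ψ)) wk′)))

  rainbowPathSeq-relabel : ∀ {ℓ vs} → RainbowPathSeq G ℓ vs → RainbowPathSeq H ℓ vs
  rainbowPathSeq-relabel {vs = vs} (len , u , cs , wk , ucs) with rainbowWalk-relabel {vs} wk ucs
  ... | wk′ , ucs′ = len , u , map φ cs , wk′ , ucs′

  rainbowCycleSeq-relabel : ∀ {ℓ} vs → RainbowCycleSeq G ℓ vs → RainbowCycleSeq H ℓ vs
  rainbowCycleSeq-relabel []      ()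
  rainbowCycleSeq-relabel (v ∷ vs) (len , u , cs , wk , ucs) with rainbowWalk-relabel {v ∷ vs ++ [ v ]} wk ucs
  ... | wk′ , ucs′ = len , u , map φ cs , wk′ , ucs′

admissible-relabel : ∀ {n ℓ} {G H : ColGraph n} {φ ψ} → Relabelling G H φ → Relabelling H G ψ →
                     Admissible ℓ G → Admissible ℓ H
admissible-relabel G→H H→G (proper , noPath) =
  proper-relabel⁻ H→G proper , λ (vs , path) → noPath (vs , rainbowPathSeq-relabel H→G G→H path)

RelabellingInvariant : ∀ {n} → (ColGraph n → ℕ) → Set
RelabellingInvariant f = ∀ {G H φ ψ} → Relabelling G H φ → Relabelling H G ψ → f G ≡ f H

edgeCount-invariant : ∀ {n} → RelabellingInvariant {n} edgeCount
edgeCount-invariant G→H _ = sym (edgeCount-relabel G→H)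

rainbowCycleCount-invariant : ∀ {n} ℓ → RelabellingInvariant {n} (λ G → rainbowCycleCount G ℓ)
rainbowCycleCount-invariant zero    _   _   = refl
rainbowCycleCount-invariant {n} (suc k) {G} {H} G→H H→G = cong (_/ (2 * suc k)) (begin
  length (filter (rainbowCycleSeq? G (suc k)) L)             ≡⟨ length-filter≡count _ L ⟩
  count (λ vs → does (rainbowCycleSeq? G (suc k) vs)) L      ≡⟨ ∑-cong L (λ vs → cong 𝟙 (same-cycles vs)) ⟩
  count (λ vs → does (rainbowCycleSeq? H (suc k) vs)) L      ≡⟨ length-filter≡count _ L ⟨
  length (filter (rainbowCycleSeq? H (suc k)) L)             ∎)
  where
  open ≡-Reasoning
  L = allLists n (suc k)
  same-cycles : ∀ vs → does (rainbowCycleSeq? G (suc k) vs) ≡ does (rainbowCycleSeq? H (suc k) vs)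
  same-cycles vs = does-⇔ (rainbowCycleSeq? G (suc k) vs) (rainbowCycleSeq? H (suc k) vs)
                          (rainbowCycleSeq-relabel G→H H→G vs) (rainbowCycleSeq-relabel H→G G→H vs)

module _ {a} {A : Set a} (_≟_ : DecidableEquality A) where

  indexOf : A → List A → ℕ
  indexOf x []       = 0
  indexOf x (y ∷ ys) with y ≟ x
  ... | yes _ = 0
  ... | no _  = suc (indexOf x ys)

  lookupOr : A → List A → ℕ → A
  lookupOr d []       _       = d
  lookupOr d (y ∷ ys) zero    = y
  lookupOr d (y ∷ ys) (suc i) = lookupOr d ys i

  lookupOr-indexOf : ∀ d {x xs} → x ∈ xs → lookupOr d xs (indexOf x xs) ≡ x × indexOf x xs < length xs
  lookupOr-indexOf d {x} {y ∷ ys} x∈ with y ≟ x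
  ... | yes y≡x = y≡x , s≤s z≤n
  lookupOr-indexOf d (here x≡y)  | no y≢x = ⊥-elim (y≢x (sym x≡y))
  lookupOr-indexOf d (there x∈ys) | no _  with lookupOr-indexOf d x∈ys
  ... | found , bounded = found , s≤s bounded

vertexPairs : ∀ n → List (Fin n × Fin n)
vertexPairs n = cartesianProduct (allFin n) (allFin n)

colourValues : ℕ → List (Maybe ℕ)
colourValues L = nothing ∷ map just (upTo L)

-- Renumber the colours of G by the position of their first occurrence among the vertex pairs,
-- so that all colours become smaller than the number of vertex pairs.
module Compress {n : ℕ} (G : ColGraph n) where

  colourTable : List (Maybe ℕ)
  colourTable = map (λ (u , v) → col G u v) (vertexPairs n)

  compress decompress : ℕ → ℕ
  compress c   = indexOf (Maybeₚ.≡-dec _≟_) (just c) colourTable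
  decompress i = fromMaybe 0 (lookupOr (Maybeₚ.≡-dec _≟_) nothing colourTable i)

  compressed : ColGraph n
  compressed = record
    { col    = λ u v → Maybe.map compress (col G u v)
    ; sym    = λ u v → cong (Maybe.map compress) (col-sym G u v)
    ; irrefl = λ v → cong (Maybe.map compress) (irrefl G v)
    }

  private
    in-table : ∀ {u v c} → col G u v ≡ just c →
               decompress (compress c) ≡ c × compress c < length (vertexPairs n)
    in-table {u} {v} {c} uv≡c with lookupOr-indexOf (Maybeₚ.≡-dec _≟_) nothing c∈table
      where
      c∈table : just c ∈ colourTable
      c∈table = subst (_∈ colourTable) uv≡c (∈-map⁺ _ (∈-cartesianProduct⁺ (∈-allFin u) (∈-allFin v)))
    ... | found , bounded = cong (fromMaybe 0) found , subst (compress c <_) (length-map _ (vertexPairs n)) bounded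

  decompress-relabel : Relabelling compressed G decompress
  decompress-relabel = relabelling decompress-col
    where
    decompress-col : ∀ u v → col G u v ≡ Maybe.map decompress (col compressed u v)
    decompress-col u v with col G u v in uv
    ... | nothing = refl
    ... | just c  = cong just (sym (proj₁ (in-table uv)))

  compressed-colours : ∀ u v → col compressed u v ∈ colourValues (length (vertexPairs n))
  compressed-colours u v with col G u v in uv
  ... | nothing = here refl
  ... | just c  = there (∈-map⁺ just (∈-upTo⁺ (proj₂ (in-table uv))))

module _ {a} {A : Set a} where

  functions : ∀ m → List A → List (Fin m → A)
  functions zero    xs = [ Vector.[] ]
  functions (suc m) xs = concatMap (λ x → map (x Vector.∷_) (functions m xs)) xs

  functions-complete : ∀ (R : A → A → Set) m xs (f : Fin m → A) → (∀ i → ∃[ x ] (x ∈ xs × R x (f i))) →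
                       ∃[ g ] (g ∈ functions m xs × ∀ i → R (g i) (f i))
  functions-complete R zero    xs f _     = Vector.[] , here refl , λ ()
  functions-complete R (suc m) xs f close
    with close Fin.zero | functions-complete R m xs (λ i → f (Fin.suc i)) (λ i → close (Fin.suc i))
  ... | x , x∈xs , Rx | g , g∈ , Rg =
    x Vector.∷ g ,
    ∈-concatMap⁺ (λ y → map (y Vector.∷_) (functions m xs)) (lose x∈xs (∈-map⁺ (x Vector.∷_) g∈)) ,
    λ { Fin.zero → Rx ; (Fin.suc i) → Rg i }

module _ {n : ℕ} where

  symmetrise : (Fin n → Fin n → Maybe ℕ) → ColGraph n
  symmetrise r = record { col = sym-col ; sym = sym-col-sym ; irrefl = sym-col-irrefl }
    where
    sym-col : Fin n → Fin n → Maybe ℕ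
    sym-col u v = if toℕ u <ᵇ toℕ v then r u v else if toℕ v <ᵇ toℕ u then r v u else nothing

    sym-col-sym : ∀ u v → sym-col u v ≡ sym-col v u
    sym-col-sym u v with toℕ u <ᵇ toℕ v | <ᵇ-reflects-< (toℕ u) (toℕ v)
                       | toℕ v <ᵇ toℕ u | <ᵇ-reflects-< (toℕ v) (toℕ u)
    ... | true  | ofʸ u<v | true  | ofʸ v<u = ⊥-elim (<-asym u<v v<u)
    ... | true  | _       | false | _       = refl
    ... | false | _       | true  | _       = refl
    ... | false | _       | false | _       = refl

    sym-col-irrefl : ∀ v → sym-col v v ≡ nothing
    sym-col-irrefl v with toℕ v <ᵇ toℕ v | <ᵇ-reflects-< (toℕ v) (toℕ v)
    ... | true  | ofʸ v<v = ⊥-elim (<-irrefl refl v<v)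
    ... | false | _       = refl

  symmetrise-agrees : ∀ r (K : ColGraph n) → (∀ u v → r u v ≡ col K u v) →
                      ∀ u v → col (symmetrise r) u v ≡ col K u v
  symmetrise-agrees r K r≗K u v with toℕ u <ᵇ toℕ v | <ᵇ-reflects-< (toℕ u) (toℕ v)
                                   | toℕ v <ᵇ toℕ u | <ᵇ-reflects-< (toℕ v) (toℕ u)
  ... | true  | _        | _     | _        = r≗K u v
  ... | false | _        | true  | _        = trans (r≗K v u) (col-sym K v u)
  ... | false | ofⁿ u≮v  | false | ofⁿ v≮u with Finₚ.≤-antisym (≮⇒≥ v≮u) (≮⇒≥ u≮v)
  ...   | refl = sym (irrefl K u)

  graphsColouredBelow : ℕ → List (ColGraph n)
  graphsColouredBelow L = map symmetrise (functions n (functions n (colourValues L)))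

  graphs-complete : ∀ G → ∃₂ λ K φ → ∃[ ψ ] (K ∈ graphsColouredBelow (length (vertexPairs n)) ×
                                            Relabelling G K φ × Relabelling K G ψ)
  graphs-complete G =
    symmetrise table , compress , decompress , ∈-map⁺ symmetrise table∈ ,
    relabelling table≗ ,
    relabelling (λ u v → trans (recolours decompress-relabel u v) (cong (Maybe.map decompress) (sym (table≗ u v))))
    where
    open Compress G
    row : ∀ u → ∃[ g ] (g ∈ functions n (colourValues _) × ∀ v → g v ≡ col compressed u v)
    row u = functions-complete _≡_ n _ (col compressed u) (λ v → _ , compressed-colours u v , refl)
    rows = functions-complete (λ g g′ → ∀ v → g v ≡ g′ v) n _ (col compressed) row
    table = proj₁ rows
    table∈ = proj₁ (proj₂ rows)
    table≗ : ∀ u v → col (symmetrise table) u v ≡ col compressed u v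
    table≗ = symmetrise-agrees table compressed (proj₂ (proj₂ rows))

allLists-complete : ∀ {n} (vs : List (Fin n)) → vs ∈ allLists n (length vs)
allLists-complete     []       = here refl
allLists-complete {n} (v ∷ vs) =
  ∈-concatMap⁺ (λ w → map (w ∷_) (allLists n (length vs)))
               (lose (∈-allFin v) (∈-map⁺ (v ∷_) (allLists-complete vs)))

module _ {n : ℕ} (G : ColGraph n) where

  proper? : Dec (Proper G)
  proper? = Finₚ.all? λ u → Finₚ.all? λ v → Finₚ.all? λ w → properAt? u v w
    where
    properAt? : ∀ u v w → Dec (∀ c → col G u v ≡ just c → col G u w ≡ just c → v ≡ w)
    properAt? u v w with v Finₚ.≟ w | col G u v | col G u w
    ... | yes v≡w | _      | _       = yes λ _ _ _ → v≡w
    ... | no _    | nothing | _      = yes λ _ ()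
    ... | no _    | just _ | nothing = yes λ _ _ ()
    ... | no v≢w  | just c | just c′ with c ≟ c′
    ...   | yes refl = no λ proper → v≢w (proper c refl refl)
    ...   | no c≢c′  = yes λ { _ refl refl → ⊥-elim (c≢c′ refl) }

  rainbowColours? : (m : Maybe (List ℕ)) → Dec (∃[ cs ] (m ≡ just cs × Unique cs))
  rainbowColours? nothing   = no λ { (_ , () , _) }
  rainbowColours? (just cs) = map′ (λ u → cs , refl , u) (λ { (_ , refl , u) → u }) (UniqueDec.unique? _≟_ cs)

  rainbowPathSeq? : ∀ ℓ vs → Dec (RainbowPathSeq G ℓ vs)
  rainbowPathSeq? ℓ vs =
    (length vs ≟ suc ℓ) ×-dec (UniqueDec.unique? Finₚ._≟_ vs ×-dec rainbowColours? (walkColours G vs))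

  hasRainbowPath? : ∀ ℓ → Dec (HasRainbowPath G ℓ)
  hasRainbowPath? ℓ = map′ Any.satisfied
    (λ (vs , path@(len , _)) → lose (subst (λ k → vs ∈ allLists n k) len (allLists-complete vs)) path)
    (Any.any? (rainbowPathSeq? ℓ) (allLists n (suc ℓ)))

  admissible? : ∀ ℓ → Dec (Admissible ℓ G)
  admissible? ℓ = proper? ×-dec ¬? (hasRainbowPath? ℓ)

emptyGraph : ∀ {n} → ColGraph n
emptyGraph = record { col = λ _ _ → nothing ; sym = λ _ _ → refl ; irrefl = λ _ → refl }

emptyGraph-admissible : ∀ {n} ℓ → Admissible (suc ℓ) (emptyGraph {n})
emptyGraph-admissible ℓ =
  (λ _ _ _ _ ()) , λ { ([] , () , _) ; (_ ∷ [] , () , _) ; (_ ∷ _ ∷ _ , _ , _ , _ , () , _) }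

maximum-exists : ∀ n ℓ (f : ColGraph n → ℕ) → RelabellingInvariant f → ∃[ M ] IsMaxOver n (suc ℓ) f M
maximum-exists n ℓ f invariant = f best , (best , best-admissible , refl) , best-is-max
  where
  adm? : ∀ G → Dec (Admissible (suc ℓ) G)
  adm? G = admissible? G (suc ℓ)
  graphs candidates : List (ColGraph n)
  graphs     = graphsColouredBelow (length (vertexPairs n))
  candidates = filter adm? graphs
  best : ColGraph n
  best = argmax f emptyGraph candidates
  best-admissible : Admissible (suc ℓ) best
  best-admissible = argmax-all f (emptyGraph-admissible ℓ) (all-filter adm? graphs)
  best-is-max : ∀ G → Admissible (suc ℓ) G → f G ≤ f best
  best-is-max G adm with graphs-complete G
  ... | K , _ , _ , K∈ , G→K , K→G =
    subst (_≤ f best) (sym (invariant G→K K→G))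
          (All.lookup (f[xs]≤f[argmax] emptyGraph candidates) (∈-filter⁺ adm? K∈ (admissible-relabel G→K K→G adm)))

theorem7 : ∀ (ℓ : ℕ) → 3 ≤ ℓ →
  ∃[ c ] (∀ (n : ℕ) → ∃[ M₁ ] ∃[ M₂ ]
    (IsExStarCyclePath n ℓ M₁ × IsExStarPath n ℓ M₂ ×
     M₁ ≤ (2 * ℓ ∸ 3) ^ (ℓ ∸ 2) * M₂ × M₂ ≤ c * n))
theorem7 (suc zero)    (s≤s ())
theorem7 (suc (suc k)) _ = 2 * ℓ , bounds
  where
  ℓ = suc (suc k)
  bounds : ∀ n → ∃[ M₁ ] ∃[ M₂ ] (IsExStarCyclePath n ℓ M₁ × IsExStarPath n ℓ M₂ ×
                                 M₁ ≤ (2 * ℓ ∸ 3) ^ k * M₂ × M₂ ≤ 2 * ℓ * n)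
  bounds n
    with maximum-exists n (suc k) (λ G → rainbowCycleCount G ℓ) (rainbowCycleCount-invariant ℓ)
       | maximum-exists n (suc k) edgeCount edgeCount-invariant
  ... | _ , max₁@((G₁ , adm₁ , refl) , _) | _ , max₂@((G₂ , adm₂ , refl) , edgeCount≤max) =
    _ , _ , max₁ , max₂ ,
    ≤-trans (rainbowCycleCount≤ k adm₁) (*-monoʳ-≤ ((2 * ℓ ∸ 3) ^ k) (edgeCount≤max G₁ adm₁)) ,
    edgeCount≤ adm₂
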